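{- For every sufficiently large integer $p$, setting $w=\lceil\log_{3/2}p\rceil$ (so that $p\geq p_w$), we have $|E(G_{w,p})|\leq5\cdot2^{p}p\log_{3/2}p+O(2^{p}p)$, where the implied constant in the $O$-term is absolute.
   Context: For integers $w,p\geq0$ define $\alpha(w,p)=\frac{1}{1+(2/3)^{w}}\Big(\frac{2+(2/3)^{w}}{1+(2/3)^{w}}\Big)^{p-1}$, $\beta(w)=3(\frac{3}{2})^{w}$ and $\delta(w)=(2+(\frac{2}{3})^{w})\beta(w)$. Let $p_w$ be the smallest integer such that $\alpha(w,p_w+1)\geq\beta(w)$. For $p\geq p_w$ define $G_{w,p}$ recursively: $G_{w,p_w}$ is the complete graph $K_{\lceil\delta(w)\rceil}$, and for $p\geq p_w+1$, $G_{w,p}$ is obtained from a complete graph $K_{w+1}$ and two disjoint copies of $G_{w,p-1}$ by adding all edges between the vertices of $K_{w+1}$ and the vertices of the two copies. -}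

module Defs where

open import Data.Nat as ℕ using (ℕ; zero; suc; _+_; _*_; _∸_; _^_; _≤_; _<_)
open import Data.Integer as ℤ using (ℤ; +_; -[1+_])
open import Data.Rational as ℚ using (ℚ; 0ℚ; 1ℚ; _/_; ceiling)
open import Data.Fin as Fin using (Fin)
open import Data.Bool using (Bool; true; false; _∧_; not)
open import Data.Sum using (_⊎_; inj₁; inj₂)
open import Data.Product using (_×_; _,_)
open import Data.List using (List; []; _∷_; _++_; map; allFin; cartesianProduct; length; filter)
open import Data.Unit using (⊤)
open import Relation.Nullary.Decidable using (isYes; ¬?)
open import Relation.Nullary using (¬_)
open import Relation.Binary.PropositionalEquality using (_≡_)
import Data.Bool.Properties as BoolP
import Data.Nat.Properties as NP

infixr 8 _^ℚ_
_^ℚ_ : ℚ → ℕ → ℚ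
q ^ℚ zero  = 1ℚ
q ^ℚ suc n = q ℚ.* (q ^ℚ n)

r : ℕ → ℚ
r w = (+ 2 / 3) ^ℚ w

-- α(w,p) = 1/(1+r) * ((2+r)/(1+r))^(p-1), for p ≥ 1 (written with p = suc q,
-- so that p - 1 = q is a natural number; α is only ever used at p = p_w + 1).
-- 1/(1+r) and (2+r)/(1+r) are written as 3^w/(3^w+2^w) and (2·3^w+2^w)/(3^w+2^w),
-- which is literally (2/3)^w = 2^w/3^w substituted.
nzS : ∀ w → ℕ.NonZero (3 ^ w + 2 ^ w)
nzS w = ℕ.>-nonZero (NP.<-≤-trans (NP.m^n>0 3 w) (NP.m≤m+n (3 ^ w) (2 ^ w)))

αsuc : ℕ → ℕ → ℚ
αsuc w q = (_/_ (+ (3 ^ w)) (3 ^ w + 2 ^ w) {{nzS w}})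
           ℚ.* ((_/_ (+ (2 * 3 ^ w + 2 ^ w)) (3 ^ w + 2 ^ w) {{nzS w}}) ^ℚ q)

β : ℕ → ℚ
β w = (+ 3 / 1) ℚ.* ((+ 3 / 2) ^ℚ w)

δ : ℕ → ℚ
δ w = ((+ 2 / 1) ℚ.+ r w) ℚ.* β w

-- ⌈δ(w)⌉ as a natural number (δ(w) > 0)
dsize : ℕ → ℕ
dsize w = ℤ.∣ ceiling (δ w) ∣

IsPw : ℕ → ℕ → Set
IsPw w pw = (β w ℚ.≤ αsuc w pw) × (∀ q → q < pw → ¬ (β w ℚ.≤ αsuc w q))

-- The graphs.  GVtx w k = vertex set of G_{w, p_w + k}.
GVtx : ℕ → ℕ → Set
GVtx w zero    = Fin (dsize w)
GVtx w (suc k) = Fin (suc w) ⊎ (Bool × GVtx w k)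

gadj : ∀ w k → GVtx w k → GVtx w k → Bool
gadj w zero    i j = not (isYes (i Fin.≟ j))
gadj w (suc k) (inj₁ i) (inj₁ j) = not (isYes (i Fin.≟ j))
gadj w (suc k) (inj₁ i) (inj₂ _) = true
gadj w (suc k) (inj₂ _) (inj₁ j) = true
gadj w (suc k) (inj₂ (b , u)) (inj₂ (c , v)) =
  isYes (b BoolP.≟ c) ∧ gadj w k u v

gverts : ∀ w k → List (GVtx w k)
gverts w zero    = allFin (dsize w)
gverts w (suc k) = map inj₁ (allFin (suc w))
                   ++ map inj₂ (cartesianProduct (true ∷ false ∷ []) (gverts w k))

-- number of unordered adjacent pairs in a duplicate-free list of vertices
pairCount : ∀ {A : Set} → (A → A → Bool) → List A → ℕ
pairCount adj []       = 0
pairCount adj (x ∷ xs) = length (filter (λ y → adj x y BoolP.≟ true) xs)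
                         + pairCount adj xs

-- |E(G_{w,p})|, for p ≥ pw (pw = p_w)
edgesG : (w pw p : ℕ) → ℕ
edgesG w pw p = pairCount (gadj w (p ∸ pw)) (gverts w (p ∸ pw))

-- w = ⌈log_{3/2} p⌉  (for p ≥ 1): w is the least natural number with (3/2)^w ≥ p
IsCeilLog : ℕ → ℕ → Set
IsCeilLog p w = ((+ p / 1) ℚ.≤ (+ 3 / 2) ^ℚ w)
              × (∀ v → v < w → ¬ ((+ p / 1) ℚ.≤ (+ 3 / 2) ^ℚ v))

-- LeMulLog a b p  means  a ≤ b · log_{3/2} p   (a ∈ ℤ, b ∈ ℕ, p ≥ 1),
-- i.e. (3/2)^a ≤ p^b, i.e. (for a ≥ 0) 3^a ≤ p^b · 2^a; trivially true for a < 0.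
LeMulLog : ℤ → ℕ → ℕ → Set
LeMulLog (+ n)    b p = 3 ^ n ≤ p ^ b * 2 ^ n
LeMulLog -[1+ n ] b p = ⊤

-- The graph G_{w,p_w+k} arises from K_D, D = ⌈δ(w)⌉, by k steps that each take two copies and join
-- them completely to a new K_{w+1}. Counting gives 2^k (D + w + 1) − (w + 1) vertices and at most
-- 2^k (D² + k (w+1)(D + w + 1)) edges. The minimality of p_w enters twice: β(w) ≤ α(w, p_w + 1)
-- forces 2^{p_w} ≥ 3 (3/2)^w, which trades 2^k for 2^p (2/3)^w / 3; and since (3/2)^{w-1} < p,
-- the inequality α(w, p + 1) ≥ β(w) already holds for p ≥ 10, so p_w ≤ p. With k ≤ p and
-- D < 6 (3/2)^w + 4 ≤ 13 p everything collapses to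
-- |E| ≤ 2^p p (48 + 4w) ≤ 53 · 2^p p + 5 · 2^p p log_{3/2} p.

module Submission where

open import Defs
open import Data.Nat using (ℕ; _≤_; _*_; _^_)
open import Data.Integer using (+_; _-_)
open import Data.Product using (Σ; _×_)

open import Data.Nat as ℕ
open import Data.Nat.Properties
open import Data.Nat.Tactic.RingSolver
open import Data.Integer as ℤ using (+_; -[1+_]; +[1+_])
import Data.Integer.Properties as ℤ
import Data.Integer.Tactic.RingSolver as ℤ
open import Data.Integer.DivMod using ([n/ℕd]*d≤n; n<s[n/ℕd]*d)
import Data.Rational as ℚ
open import Data.Rational using (ℚ; mkℚ; toℚᵘ; ceiling)
import Data.Rational.Properties as ℚ
open import Data.Rational.Unnormalised as ℚᵘ using (ℚᵘ; mkℚᵘ; *≡*; *≤*)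
open import Data.List using (List; []; _∷_; _++_; map; length; filter; allFin)
open import Data.List.Properties
  using (length-filter; filter-++; length-++; length-map; length-tabulate; ++-identityʳ)
open import Data.Bool using (Bool; true; false)
import Data.Bool.Properties as BoolP
open import Data.Product using (_,_; proj₁; proj₂)
open import Data.Sum using (inj₁; inj₂)
open import Data.Unit using (tt)
open import Relation.Binary.PropositionalEquality
open import Relation.Nullary using (yes; no; contradiction)
open import Relation.Nullary.Decidable using (toWitness)

module PairCount where

  private variable A B : Set

  degreeIn : (A → A → Bool) → A → List A → ℕ
  degreeIn adj x ys = length (filter (λ y → adj x y BoolP.≟ true) ys)

  crossCount : (A → A → Bool) → List A → List A → ℕ
  crossCount adj []       ys = 0
  crossCount adj (x ∷ xs) ys = degreeIn adj x ys + crossCount adj xs ys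

  degreeIn-++ : ∀ (adj : A → A → Bool) x xs ys →
                degreeIn adj x (xs ++ ys) ≡ degreeIn adj x xs + degreeIn adj x ys
  degreeIn-++ adj x xs ys =
    trans (cong length (filter-++ _ xs ys)) (length-++ (filter _ xs))

  degreeIn≤length : ∀ (adj : A → A → Bool) x ys → degreeIn adj x ys ≤ length ys
  degreeIn≤length adj x = length-filter _

  crossCount≤length*length : ∀ (adj : A → A → Bool) xs ys →
                             crossCount adj xs ys ≤ length xs * length ys
  crossCount≤length*length adj []       ys = z≤n
  crossCount≤length*length adj (x ∷ xs) ys =
    +-mono-≤ (degreeIn≤length adj x ys) (crossCount≤length*length adj xs ys)

  pairCount≤length*length : ∀ (adj : A → A → Bool) xs →
                            pairCount adj xs ≤ length xs * length xs
  pairCount≤length*length adj []       = z≤n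
  pairCount≤length*length adj (x ∷ xs) = begin
    degreeIn adj x xs + pairCount adj xs
      ≤⟨ +-mono-≤ (degreeIn≤length adj x xs) (pairCount≤length*length adj xs) ⟩
    n + n * n
      ≤⟨ +-monoʳ-≤ n (*-monoʳ-≤ n (n≤1+n n)) ⟩
    n + n * suc n
      ≤⟨ n≤1+n _ ⟩
    suc n * suc n ∎
    where
    open ≤-Reasoning
    n = length xs

  pairCount-++ : ∀ (adj : A → A → Bool) xs ys →
                 pairCount adj (xs ++ ys) ≡ pairCount adj xs + pairCount adj ys + crossCount adj xs ys
  pairCount-++ adj []       ys = sym (+-identityʳ _)
  pairCount-++ adj (x ∷ xs) ys
    rewrite degreeIn-++ adj x xs ys | pairCount-++ adj xs ys =
      shuffle (degreeIn adj x xs) (degreeIn adj x ys) (pairCount adj xs) (pairCount adj ys) (crossCount adj xs ys)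
    where
    shuffle : ∀ a b c d e → a + b + (c + d + e) ≡ a + c + d + (b + e)
    shuffle = solve-∀

  module _ (adj : A → A → Bool) (adj′ : B → B → Bool) where

    degreeIn-map : (f : A → B) → (∀ u v → adj′ (f u) (f v) ≡ adj u v) →
                   ∀ x ys → degreeIn adj′ (f x) (map f ys) ≡ degreeIn adj x ys
    degreeIn-map f f-hom x []       = refl
    degreeIn-map f f-hom x (y ∷ ys) rewrite f-hom x y with adj x y
    ... | true  = cong suc (degreeIn-map f f-hom x ys)
    ... | false = degreeIn-map f f-hom x ys

    pairCount-map : (f : A → B) → (∀ u v → adj′ (f u) (f v) ≡ adj u v) →
                    ∀ xs → pairCount adj′ (map f xs) ≡ pairCount adj xs
    pairCount-map f f-hom []       = refl
    pairCount-map f f-hom (x ∷ xs) =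
      cong₂ _+_ (degreeIn-map f f-hom x xs) (pairCount-map f f-hom xs)

  module _ (adj : B → B → Bool) (f g : A → B) (nonadjacent : ∀ u v → adj (f u) (g v) ≡ false) where

    degreeIn-nonadjacent : ∀ x ys → degreeIn adj (f x) (map g ys) ≡ 0
    degreeIn-nonadjacent x []       = refl
    degreeIn-nonadjacent x (y ∷ ys) rewrite nonadjacent x y = degreeIn-nonadjacent x ys

    crossCount-nonadjacent : ∀ xs ys → crossCount adj (map f xs) (map g ys) ≡ 0
    crossCount-nonadjacent []       ys = refl
    crossCount-nonadjacent (x ∷ xs) ys
      rewrite degreeIn-nonadjacent x ys = crossCount-nonadjacent xs ys

module GraphSize where
  open PairCount

  vertexCount : ℕ → ℕ → ℕ
  vertexCount w k = length (gverts w k)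

  edgeCount : ℕ → ℕ → ℕ
  edgeCount w k = pairCount (gadj w k) (gverts w k)

  module Successor (w k : ℕ) where

    clique : List (GVtx w (suc k))
    clique = map inj₁ (allFin (suc w))

    tag : Bool → GVtx w k → Bool × GVtx w k
    tag b u = b , u

    copy : Bool → List (Bool × GVtx w k)
    copy b = map (tag b) (gverts w k)

    copies : List (Bool × GVtx w k)
    copies = copy true ++ copy false

    copyAdj : Bool × GVtx w k → Bool × GVtx w k → Bool
    copyAdj x y = gadj w (suc k) (inj₂ x) (inj₂ y)

    gverts-suc : gverts w (suc k) ≡ clique ++ map inj₂ copies
    gverts-suc = cong (λ c → clique ++ map inj₂ (copy true ++ c)) (++-identityʳ (copy false))

    length-clique : length clique ≡ suc w
    length-clique = trans (length-map inj₁ (allFin (suc w))) (length-tabulate (λ i → i))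

    length-copies : length copies ≡ vertexCount w k + vertexCount w k
    length-copies = trans (length-++ (copy true))
      (cong₂ _+_ (length-map (tag true) (gverts w k)) (length-map (tag false) (gverts w k)))

    pairCount-copies : pairCount copyAdj copies ≡ edgeCount w k + edgeCount w k
    pairCount-copies
      rewrite pairCount-++ copyAdj (copy true) (copy false)
            | pairCount-map (gadj w k) copyAdj (tag true) (λ _ _ → refl) (gverts w k)
            | pairCount-map (gadj w k) copyAdj (tag false) (λ _ _ → refl) (gverts w k)
            | crossCount-nonadjacent copyAdj (tag true) (tag false) (λ _ _ → refl) (gverts w k) (gverts w k)
            = +-identityʳ _

    vertexCount-suc : vertexCount w (suc k) ≡ suc w + (vertexCount w k + vertexCount w k)
    vertexCount-suc = begin
      length (gverts w (suc k))                   ≡⟨ cong length gverts-suc ⟩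
      length (clique ++ map inj₂ copies)          ≡⟨ length-++ clique ⟩
      length clique + length (map inj₂ copies)    ≡⟨ cong₂ _+_ length-clique (length-map inj₂ copies) ⟩
      suc w + length copies                       ≡⟨ cong (_+_ (suc w)) length-copies ⟩
      suc w + (vertexCount w k + vertexCount w k) ∎
      where open ≡-Reasoning

    edgeCount-suc-≤ : edgeCount w (suc k) ≤
      suc w * suc w + (edgeCount w k + edgeCount w k) + suc w * (vertexCount w k + vertexCount w k)
    edgeCount-suc-≤ = begin
      pairCount G (gverts w (suc k))
        ≡⟨ cong (pairCount G) gverts-suc ⟩
      pairCount G (clique ++ joined)
        ≡⟨ pairCount-++ G clique joined ⟩
      pairCount G clique + pairCount G joined + crossCount G clique joined
        ≤⟨ +-mono-≤ (+-mono-≤ (pairCount≤length*length G clique) (≤-reflexive pairCount-joined))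
                    (crossCount≤length*length G clique joined) ⟩
      length clique * length clique + (E + E) + length clique * length joined
        ≡⟨ cong₂ (λ c m → c * c + (E + E) + c * m) length-clique length-joined ⟩
      suc w * suc w + (E + E) + suc w * (n + n) ∎
      where
      open ≤-Reasoning
      G = gadj w (suc k)
      E = edgeCount w k
      n = vertexCount w k
      joined = map inj₂ copies
      pairCount-joined : pairCount G joined ≡ E + E
      pairCount-joined = trans (pairCount-map copyAdj G inj₂ (λ _ _ → refl) copies) pairCount-copies
      length-joined : length joined ≡ n + n
      length-joined = trans (length-map inj₂ copies) length-copies

  vertexCount+clique : ∀ w k → vertexCount w k + suc w ≡ 2 ^ k * (dsize w + suc w)
  vertexCount+clique w zero =
    trans (cong (_+ suc w) (length-tabulate {n = dsize w} (λ i → i))) (sym (+-identityʳ _))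
  vertexCount+clique w (suc k) = begin
    vertexCount w (suc k) + s       ≡⟨ cong (_+ s) (Successor.vertexCount-suc w k) ⟩
    s + (n + n) + s                 ≡⟨ regroup s n ⟩
    (n + s) + (n + s)               ≡⟨ cong (λ t → t + t) (vertexCount+clique w k) ⟩
    2 ^ k * m + 2 ^ k * m           ≡⟨ double (2 ^ k) m ⟩
    2 ^ suc k * m                   ∎
    where
    open ≡-Reasoning
    s = suc w
    n = vertexCount w k
    m = dsize w + suc w
    regroup : ∀ a b → a + (b + b) + a ≡ (b + a) + (b + a)
    regroup = solve-∀
    double : ∀ a b → a * b + a * b ≡ 2 * a * b
    double = solve-∀

  edgeCount-≤ : ∀ w k → edgeCount w k ≤ 2 ^ k * (dsize w * dsize w + k * (suc w * (dsize w + suc w)))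
  edgeCount-≤ w zero = begin
    edgeCount w zero  ≤⟨ pairCount≤length*length (gadj w zero) (gverts w zero) ⟩
    n * n             ≡⟨ cong (λ d → d * d) (length-tabulate {n = dsize w} (λ i → i)) ⟩
    dsize w * dsize w ≡⟨ base (dsize w * dsize w) (suc w * (dsize w + suc w)) ⟩
    2 ^ 0 * (dsize w * dsize w + 0 * (suc w * (dsize w + suc w))) ∎
    where
    open ≤-Reasoning
    n = vertexCount w zero
    base : ∀ x y → x ≡ 1 * (x + 0 * y)
    base = solve-∀
  edgeCount-≤ w (suc k) = begin
    edgeCount w (suc k)
      ≤⟨ Successor.edgeCount-suc-≤ w k ⟩
    s * s + (E + E) + s * (n + n)
      ≡⟨ regroup s E n ⟩
    (E + E) + (s * s + s * (n + n))
      ≤⟨ +-monoʳ-≤ (E + E) (m≤m+n _ (s * s)) ⟩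
    (E + E) + (s * s + s * (n + n) + s * s)
      ≡⟨ cong (_+_ (E + E)) (factor s n) ⟩
    (E + E) + (s * (n + s) + s * (n + s))
      ≡⟨ cong (λ t → (E + E) + (s * t + s * t)) (vertexCount+clique w k) ⟩
    (E + E) + (s * (2 ^ k * m) + s * (2 ^ k * m))
      ≤⟨ +-monoˡ-≤ _ (+-mono-≤ (edgeCount-≤ w k) (edgeCount-≤ w k)) ⟩
    2 ^ k * B + 2 ^ k * B + (s * (2 ^ k * m) + s * (2 ^ k * m))
      ≡⟨ collect (2 ^ k) D k s m ⟩
    2 ^ suc k * (D * D + suc k * (s * m)) ∎
    where
    open ≤-Reasoning
    s = suc w
    D = dsize w
    m = D + s
    n = vertexCount w k
    E = edgeCount w k
    B = D * D + k * (s * m)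
    regroup : ∀ a b c → a * a + (b + b) + a * (c + c) ≡ (b + b) + (a * a + a * (c + c))
    regroup = solve-∀
    factor : ∀ a c → a * a + a * (c + c) + a * a ≡ a * (c + a) + a * (c + a)
    factor = solve-∀
    collect : ∀ P D k s m → P * (D * D + k * (s * m)) + P * (D * D + k * (s * m)) + (s * (P * m) + s * (P * m))
              ≡ 2 * P * (D * D + (1 + k) * (s * m))
    collect = solve-∀

open PairCount
open GraphSize

module Powers where

  private
    3*[2*x]≡2*[3*x] : ∀ x → 3 * (2 * x) ≡ 2 * (3 * x)
    3*[2*x]≡2*[3*x] = solve-∀

  ^-distribʳ-* : ∀ m n o → (m * n) ^ o ≡ m ^ o * n ^ o
  ^-distribʳ-* m n zero    = refl
  ^-distribʳ-* m n (suc o) rewrite ^-distribʳ-* m n o = interchange m n (m ^ o) (n ^ o)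
    where
    interchange : ∀ a b x y → a * b * (x * y) ≡ a * x * (b * y)
    interchange = solve-∀

  module _ {m k : ℕ} .{{_ : NonZero k}} (m≤k : m ≤ k) where

    -- k^a ≤ c m^a says (k/m)^a ≤ c, which persists for smaller exponents.
    ^-ratio-≤-antitone : ∀ {c a n} → k ^ a ≤ c * m ^ a → n ≤ a → k ^ n ≤ c * m ^ n
    ^-ratio-≤-antitone {c} {a} {n} kᵃ≤cmᵃ n≤a =
      *-cancelʳ-≤ (k ^ n) (c * m ^ n) (k ^ (a ∸ n)) {{m^n≢0 k (a ∸ n)}} (begin
        k ^ n * k ^ (a ∸ n)       ≡⟨ ^-distribˡ-+-* k n (a ∸ n) ⟨
        k ^ (n + (a ∸ n))         ≡⟨ cong (k ^_) n+[a∸n]≡a ⟩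
        k ^ a                     ≤⟨ kᵃ≤cmᵃ ⟩
        c * m ^ a                 ≡⟨ cong (λ t → c * m ^ t) n+[a∸n]≡a ⟨
        c * m ^ (n + (a ∸ n))     ≡⟨ cong (c *_) (^-distribˡ-+-* m n (a ∸ n)) ⟩
        c * (m ^ n * m ^ (a ∸ n)) ≤⟨ *-monoʳ-≤ c (*-monoʳ-≤ (m ^ n) (^-monoˡ-≤ (a ∸ n) m≤k)) ⟩
        c * (m ^ n * k ^ (a ∸ n)) ≡⟨ *-assoc c (m ^ n) (k ^ (a ∸ n)) ⟨
        c * m ^ n * k ^ (a ∸ n)   ∎)
      where
      open ≤-Reasoning
      n+[a∸n]≡a = m+[n∸m]≡n n≤a

  ^-ratio-≤-^ : ∀ {m k c v} b → k ^ v ≤ c * m ^ v → k ^ (v * b) ≤ c ^ b * m ^ (v * b)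
  ^-ratio-≤-^ {m} {k} {c} {v} b kᵛ≤cmᵛ = begin
    k ^ (v * b)           ≡⟨ ^-*-assoc k v b ⟨
    (k ^ v) ^ b           ≤⟨ ^-monoˡ-≤ b kᵛ≤cmᵛ ⟩
    (c * m ^ v) ^ b       ≡⟨ ^-distribʳ-* c (m ^ v) b ⟩
    c ^ b * (m ^ v) ^ b   ≡⟨ cong (c ^ b *_) (^-*-assoc m v b) ⟩
    c ^ b * m ^ (v * b)   ∎
    where open ≤-Reasoning

  [1+n]*2^n≤2*3^n : ∀ n → suc n * 2 ^ n ≤ 2 * 3 ^ n
  [1+n]*2^n≤2*3^n zero          = s≤s z≤n
  [1+n]*2^n≤2*3^n (suc zero)    = s≤s (s≤s (s≤s (s≤s z≤n)))
  [1+n]*2^n≤2*3^n (suc n@(suc v)) = begin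
    (3 + v) * (2 * 2 ^ n)  ≡⟨ expand v (2 ^ n) ⟩
    (2 * v + 6) * 2 ^ n    ≤⟨ *-monoˡ-≤ (2 ^ n) (+-monoˡ-≤ 6 (*-monoˡ-≤ v (n≤1+n 2))) ⟩
    (3 * v + 6) * 2 ^ n    ≡⟨ factor v (2 ^ n) ⟩
    3 * (suc n * 2 ^ n)    ≤⟨ *-monoʳ-≤ 3 ([1+n]*2^n≤2*3^n n) ⟩
    3 * (2 * 3 ^ n)        ≡⟨ 3*[2*x]≡2*[3*x] (3 ^ n) ⟩
    2 * (3 * 3 ^ n)        ∎
    where
    open ≤-Reasoning
    expand : ∀ v q → (3 + v) * (2 * q) ≡ (2 * v + 6) * q
    expand = solve-∀
    factor : ∀ v q → (3 * v + 6) * q ≡ 3 * ((2 + v) * q)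
    factor = solve-∀

  [9n+6]*2^n≤2*3^n : ∀ {n} → 10 ≤ n → (9 * n + 6) * 2 ^ n ≤ 2 * 3 ^ n
  [9n+6]*2^n≤2*3^n {n} 10≤n = subst (λ t → (9 * t + 6) * 2 ^ t ≤ 2 * 3 ^ t) (m+[n∸m]≡n 10≤n) (from10 (n ∸ 10))
    where
    from10 : ∀ k → (9 * (10 + k) + 6) * 2 ^ (10 + k) ≤ 2 * 3 ^ (10 + k)
    from10 zero    = toWitness {a? = (9 * 10 + 6) * 2 ^ 10 ≤? 2 * 3 ^ 10} tt
    from10 (suc k) = begin
      (9 * (11 + k) + 6) * (2 * 2 ^ m)           ≡⟨ expand k (2 ^ m) ⟩
      (18 * k + 210) * 2 ^ m                     ≤⟨ *-monoˡ-≤ (2 ^ m) (+-monoʳ-≤ (18 * k) (m≤m+n 210 (78 + 9 * k))) ⟩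
      (18 * k + (210 + (78 + 9 * k))) * 2 ^ m    ≡⟨ factor k (2 ^ m) ⟩
      3 * ((9 * m + 6) * 2 ^ m)                  ≤⟨ *-monoʳ-≤ 3 (from10 k) ⟩
      3 * (2 * 3 ^ m)                            ≡⟨ 3*[2*x]≡2*[3*x] (3 ^ m) ⟩
      2 * (3 * 3 ^ m)                            ∎
      where
      open ≤-Reasoning
      m = 10 + k
      expand : ∀ k q → (9 * (11 + k) + 6) * (2 * q) ≡ (18 * k + 210) * q
      expand = solve-∀
      factor : ∀ k q → (18 * k + (210 + (78 + 9 * k))) * q ≡ 3 * ((9 * (10 + k) + 6) * q)
      factor = solve-∀

open Powers

module FractionalValue where

  -- x = a / b without a, b having to be coprime, so that sums, products and powers of
  -- fractions are read off without normalising.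
  IsFractionᵘ : ℚᵘ → ℕ → ℕ → Set
  IsFractionᵘ x a b = ℚᵘ.↥ x ℤ.* + b ≡ + a ℤ.* ℚᵘ.↧ x

  IsFraction : ℚ → ℕ → ℕ → Set
  IsFraction q = IsFractionᵘ (toℚᵘ q)

  isFraction-/ : ∀ a b .{{_ : ℕ.NonZero b}} → IsFraction (+ a ℚ./ b) a b
  isFraction-/ a (suc b) with ℚ.toℚᵘ-fromℚᵘ (mkℚᵘ (+ a) b)
  ... | *≡* eq = eq

  isFractionᵘ-resp-≃ : ∀ {x y a b} → x ℚᵘ.≃ y → IsFractionᵘ y a b → IsFractionᵘ x a b
  isFractionᵘ-resp-≃ {x@record{}} {y@record{}} {a} {b} (*≡* x≃y) y≐a/b =
    ℤ.*-cancelʳ-≡ _ _ (ℚᵘ.↧ y) (begin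
      ℚᵘ.↥ x ℤ.* + b ℤ.* ℚᵘ.↧ y   ≡⟨ swap (ℚᵘ.↥ x) (+ b) (ℚᵘ.↧ y) ⟩
      ℚᵘ.↥ x ℤ.* ℚᵘ.↧ y ℤ.* + b   ≡⟨ cong (ℤ._* + b) x≃y ⟩
      ℚᵘ.↥ y ℤ.* ℚᵘ.↧ x ℤ.* + b   ≡⟨ swap (ℚᵘ.↥ y) (ℚᵘ.↧ x) (+ b) ⟩
      ℚᵘ.↥ y ℤ.* + b ℤ.* ℚᵘ.↧ x   ≡⟨ cong (ℤ._* ℚᵘ.↧ x) y≐a/b ⟩
      + a ℤ.* ℚᵘ.↧ y ℤ.* ℚᵘ.↧ x   ≡⟨ swap (+ a) (ℚᵘ.↧ y) (ℚᵘ.↧ x) ⟩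
      + a ℤ.* ℚᵘ.↧ x ℤ.* ℚᵘ.↧ y   ∎)
    where
    open ≡-Reasoning
    swap : ∀ p q r → p ℤ.* q ℤ.* r ≡ p ℤ.* r ℤ.* q
    swap = ℤ.solve-∀

  isFractionᵘ-* : ∀ {x y a b c d} → IsFractionᵘ x a b → IsFractionᵘ y c d →
                  IsFractionᵘ (x ℚᵘ.* y) (a ℕ.* c) (b ℕ.* d)
  isFractionᵘ-* {mkℚᵘ nx dx} {mkℚᵘ ny dy} {a} {b} {c} {d} x≐a/b y≐c/d = begin
    (nx ℤ.* ny) ℤ.* + (b ℕ.* d)   ≡⟨ cong ((nx ℤ.* ny) ℤ.*_) (ℤ.pos-* b d) ⟩
    (nx ℤ.* ny) ℤ.* (+ b ℤ.* + d) ≡⟨ interchange nx ny (+ b) (+ d) ⟩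
    (nx ℤ.* + b) ℤ.* (ny ℤ.* + d) ≡⟨ cong₂ ℤ._*_ x≐a/b y≐c/d ⟩
    (+ a ℤ.* ex) ℤ.* (+ c ℤ.* ey) ≡⟨ interchange (+ a) ex (+ c) ey ⟩
    (+ a ℤ.* + c) ℤ.* (ex ℤ.* ey) ≡⟨ cong₂ ℤ._*_ (ℤ.pos-* a c) (ℤ.pos-* (suc dx) (suc dy)) ⟨
    + (a ℕ.* c) ℤ.* + (suc dx ℕ.* suc dy) ∎
    where
    open ≡-Reasoning
    ex = + suc dx
    ey = + suc dy
    interchange : ∀ p q r s → (p ℤ.* q) ℤ.* (r ℤ.* s) ≡ (p ℤ.* r) ℤ.* (q ℤ.* s)
    interchange = ℤ.solve-∀

  isFractionᵘ-+ : ∀ {x y a b c d} → IsFractionᵘ x a b → IsFractionᵘ y c d →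
                  IsFractionᵘ (x ℚᵘ.+ y) (a ℕ.* d ℕ.+ c ℕ.* b) (b ℕ.* d)
  isFractionᵘ-+ {mkℚᵘ nx dx} {mkℚᵘ ny dy} {a} {b} {c} {d} x≐a/b y≐c/d = begin
    (nx ℤ.* ey ℤ.+ ny ℤ.* ex) ℤ.* + (b ℕ.* d)
      ≡⟨ cong ((nx ℤ.* ey ℤ.+ ny ℤ.* ex) ℤ.*_) (ℤ.pos-* b d) ⟩
    (nx ℤ.* ey ℤ.+ ny ℤ.* ex) ℤ.* (+ b ℤ.* + d)
      ≡⟨ expand nx ey ny ex (+ b) (+ d) ⟩
    (nx ℤ.* + b) ℤ.* (ey ℤ.* + d) ℤ.+ (ny ℤ.* + d) ℤ.* (ex ℤ.* + b)
      ≡⟨ cong₂ (λ u v → u ℤ.* (ey ℤ.* + d) ℤ.+ v ℤ.* (ex ℤ.* + b)) x≐a/b y≐c/d ⟩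
    (+ a ℤ.* ex) ℤ.* (ey ℤ.* + d) ℤ.+ (+ c ℤ.* ey) ℤ.* (ex ℤ.* + b)
      ≡⟨ collect (+ a) ex ey (+ d) (+ c) (+ b) ⟩
    (+ a ℤ.* + d ℤ.+ + c ℤ.* + b) ℤ.* (ex ℤ.* ey)
      ≡⟨ cong₂ ℤ._*_ (trans (ℤ.pos-+ (a ℕ.* d) (c ℕ.* b)) (cong₂ ℤ._+_ (ℤ.pos-* a d) (ℤ.pos-* c b)))
                     (ℤ.pos-* (suc dx) (suc dy)) ⟨
    + (a ℕ.* d ℕ.+ c ℕ.* b) ℤ.* + (suc dx ℕ.* suc dy) ∎
    where
    open ≡-Reasoning
    ex = + suc dx
    ey = + suc dy
    expand : ∀ nx ey ny ex b d →
             (nx ℤ.* ey ℤ.+ ny ℤ.* ex) ℤ.* (b ℤ.* d) ≡ (nx ℤ.* b) ℤ.* (ey ℤ.* d) ℤ.+ (ny ℤ.* d) ℤ.* (ex ℤ.* b)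
    expand = ℤ.solve-∀
    collect : ∀ a ex ey d c b →
              (a ℤ.* ex) ℤ.* (ey ℤ.* d) ℤ.+ (c ℤ.* ey) ℤ.* (ex ℤ.* b) ≡ (a ℤ.* d ℤ.+ c ℤ.* b) ℤ.* (ex ℤ.* ey)
    collect = ℤ.solve-∀

  isFraction-* : ∀ {p q a b c d} → IsFraction p a b → IsFraction q c d →
                 IsFraction (p ℚ.* q) (a ℕ.* c) (b ℕ.* d)
  isFraction-* {p} {q} {a} {b} {c} {d} p≐a/b q≐c/d =
    isFractionᵘ-resp-≃ {a = a ℕ.* c} {b ℕ.* d} (ℚ.toℚᵘ-homo-* p q)
      (isFractionᵘ-* {toℚᵘ p} {toℚᵘ q} {a} {b} {c} {d} p≐a/b q≐c/d)

  isFraction-+ : ∀ {p q a b c d} → IsFraction p a b → IsFraction q c d →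
                 IsFraction (p ℚ.+ q) (a ℕ.* d ℕ.+ c ℕ.* b) (b ℕ.* d)
  isFraction-+ {p} {q} {a} {b} {c} {d} p≐a/b q≐c/d =
    isFractionᵘ-resp-≃ {a = a ℕ.* d ℕ.+ c ℕ.* b} {b ℕ.* d} (ℚ.toℚᵘ-homo-+ p q)
      (isFractionᵘ-+ {toℚᵘ p} {toℚᵘ q} {a} {b} {c} {d} p≐a/b q≐c/d)

  isFraction-^ℚ : ∀ {p a b} → IsFraction p a b → ∀ n → IsFraction (p ^ℚ n) (a ℕ.^ n) (b ℕ.^ n)
  isFraction-^ℚ p≐a/b zero    = refl
  isFraction-^ℚ {p} {a} {b} p≐a/b (suc n) =
    isFraction-* {p} {p ^ℚ n} {a} {b} p≐a/b (isFraction-^ℚ {p} {a} {b} p≐a/b n)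

  module _ {nx dx ny dy a b c d}
           (x≐a/b : IsFractionᵘ (mkℚᵘ nx dx) a b) (y≐c/d : IsFractionᵘ (mkℚᵘ ny dy) c d) where
    private
      ex = + suc dx
      ey = + suc dy
      x = mkℚᵘ nx dx
      y = mkℚᵘ ny dy
      interchange : ∀ p q r s → (p ℤ.* q) ℤ.* (r ℤ.* s) ≡ (p ℤ.* r) ℤ.* (q ℤ.* s)
      interchange = ℤ.solve-∀
      reflect : ∀ p q r s → (p ℤ.* q) ℤ.* (r ℤ.* s) ≡ (p ℤ.* s) ℤ.* (r ℤ.* q)
      reflect = ℤ.solve-∀
      rotate : ∀ p q r s → (p ℤ.* q) ℤ.* (r ℤ.* s) ≡ (p ℤ.* s) ℤ.* (q ℤ.* r)
      rotate = ℤ.solve-∀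

    isFractionᵘ-≤⇒ : x ℚᵘ.≤ y → a ℕ.* d ℕ.≤ c ℕ.* b
    isFractionᵘ-≤⇒ (*≤* x≤y) = ℤ.drop‿+≤+ (subst₂ ℤ._≤_ (sym (ℤ.pos-* a d)) (sym (ℤ.pos-* c b))
      (ℤ.*-cancelʳ-≤-pos _ _ (ex ℤ.* ey) (begin
        (+ a ℤ.* + d) ℤ.* (ex ℤ.* ey) ≡⟨ rotate (+ a) ex ey (+ d) ⟨
        (+ a ℤ.* ex) ℤ.* (ey ℤ.* + d) ≡⟨ cong (ℤ._* (ey ℤ.* + d)) x≐a/b ⟨
        (nx ℤ.* + b) ℤ.* (ey ℤ.* + d) ≡⟨ interchange nx ey (+ b) (+ d) ⟨
        (nx ℤ.* ey) ℤ.* (+ b ℤ.* + d) ≤⟨ ℤ.*-monoʳ-≤-nonNeg (+ b ℤ.* + d) {{bd≥0}} x≤y ⟩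
        (ny ℤ.* ex) ℤ.* (+ b ℤ.* + d) ≡⟨ reflect ny ex (+ b) (+ d) ⟩
        (ny ℤ.* + d) ℤ.* (+ b ℤ.* ex) ≡⟨ cong (ℤ._* (+ b ℤ.* ex)) y≐c/d ⟩
        (+ c ℤ.* ey) ℤ.* (+ b ℤ.* ex) ≡⟨ interchange (+ c) ey (+ b) ex ⟩
        (+ c ℤ.* + b) ℤ.* (ey ℤ.* ex) ≡⟨ cong ((+ c ℤ.* + b) ℤ.*_) (ℤ.*-comm ey ex) ⟩
        (+ c ℤ.* + b) ℤ.* (ex ℤ.* ey) ∎)))
      where
      open ℤ.≤-Reasoning
      bd≥0 : ℤ.NonNegative (+ b ℤ.* + d)
      bd≥0 = subst ℤ.NonNegative (ℤ.pos-* b d) ℤ.nonNeg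

    isFractionᵘ-≤⇐ : .{{_ : ℕ.NonZero b}} → .{{_ : ℕ.NonZero d}} → a ℕ.* d ℕ.≤ c ℕ.* b → x ℚᵘ.≤ y
    isFractionᵘ-≤⇐ ad≤cb = *≤* (ℤ.*-cancelʳ-≤-pos _ _ (+ b ℤ.* + d) {{bd>0}} (begin
        (nx ℤ.* ey) ℤ.* (+ b ℤ.* + d) ≡⟨ interchange nx ey (+ b) (+ d) ⟩
        (nx ℤ.* + b) ℤ.* (ey ℤ.* + d) ≡⟨ cong (ℤ._* (ey ℤ.* + d)) x≐a/b ⟩
        (+ a ℤ.* ex) ℤ.* (ey ℤ.* + d) ≡⟨ rotate (+ a) ex ey (+ d) ⟩
        (+ a ℤ.* + d) ℤ.* (ex ℤ.* ey) ≤⟨ ℤ.*-monoʳ-≤-nonNeg (ex ℤ.* ey) ad≤cb′ ⟩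
        (+ c ℤ.* + b) ℤ.* (ex ℤ.* ey) ≡⟨ cong ((+ c ℤ.* + b) ℤ.*_) (ℤ.*-comm ex ey) ⟩
        (+ c ℤ.* + b) ℤ.* (ey ℤ.* ex) ≡⟨ interchange (+ c) ey (+ b) ex ⟨
        (+ c ℤ.* ey) ℤ.* (+ b ℤ.* ex) ≡⟨ cong (ℤ._* (+ b ℤ.* ex)) y≐c/d ⟨
        (ny ℤ.* + d) ℤ.* (+ b ℤ.* ex) ≡⟨ reflect ny ex (+ b) (+ d) ⟨
        (ny ℤ.* ex) ℤ.* (+ b ℤ.* + d) ∎))
      where
      open ℤ.≤-Reasoning
      ad≤cb′ : + a ℤ.* + d ℤ.≤ + c ℤ.* + b
      ad≤cb′ = subst₂ ℤ._≤_ (ℤ.pos-* a d) (ℤ.pos-* c b) (ℤ.+≤+ ad≤cb)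
      bd>0 : ℤ.Positive (+ b ℤ.* + d)
      bd>0 = subst ℤ.Positive (ℤ.pos-* b d) (ℤ.positive (ℤ.+<+ (ℕ.>-nonZero⁻¹ (b ℕ.* d) {{m*n≢0 b d}})))

  isFraction-≤⇒ : ∀ {p q a b c d} → IsFraction p a b → IsFraction q c d → p ℚ.≤ q → a ℕ.* d ℕ.≤ c ℕ.* b
  isFraction-≤⇒ {p@record{}} {q@record{}} {a} {b} {c} {d} p≐a/b q≐c/d p≤q =
    isFractionᵘ-≤⇒ {a = a} {b = b} {c = c} {d = d} p≐a/b q≐c/d (ℚ.toℚᵘ-mono-≤ p≤q)

  isFraction-≤⇐ : ∀ {p q a b c d} → IsFraction p a b → IsFraction q c d →
                  .{{_ : ℕ.NonZero b}} → .{{_ : ℕ.NonZero d}} → a ℕ.* d ℕ.≤ c ℕ.* b → p ℚ.≤ q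
  isFraction-≤⇐ {p@record{}} {q@record{}} {a} {b} {c} {d} p≐a/b q≐c/d ad≤cb =
    ℚ.toℚᵘ-cancel-≤ (isFractionᵘ-≤⇐ {a = a} {b = b} {c = c} {d = d} p≐a/b q≐c/d ad≤cb)

  ceiling≡-[-↥/↧] : ∀ q → ceiling q ≡ ℤ.- ((ℤ.- ℚ.↥ q) ℤ./ℕ ℚ.↧ₙ q)
  ceiling≡-[-↥/↧] (mkℚ -[1+ k ] d c) = cong ℤ.-_ (ℤ.*-identityˡ _)
  ceiling≡-[-↥/↧] (mkℚ (+ zero) d c) = refl
  ceiling≡-[-↥/↧] (mkℚ +[1+ k ] d c) = cong ℤ.-_ (ℤ.*-identityˡ _)

  -- With Q = ⌊-↥q / ↧q⌋ we have ⌈q⌉ = -Q and -↥q < (Q + 1) ↧q; multiply through by b.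
  ∣ceiling∣*b<a+b : ∀ q a b .{{_ : ℕ.NonZero b}} → IsFraction q a b → ℤ.∣ ceiling q ∣ ℕ.* b ℕ.< a ℕ.+ b
  ∣ceiling∣*b<a+b q@(mkℚ n d c) a b@(suc _) n*b≡a*d′ =
    ℤ.drop‿+<+ (subst₂ ℤ._<_ (sym (ℤ.pos-* ∣⌈q⌉∣ b)) (sym (ℤ.pos-+ a b)) ∣⌈q⌉∣*b<a+b)
    where
    d′ = + suc d
    Q = (ℤ.- n) ℤ./ℕ suc d
    0≤n : ℤ.0ℤ ℤ.≤ n
    0≤n = ℤ.*-cancelʳ-≤-pos ℤ.0ℤ n (+ b)
      (subst (ℤ.0ℤ ℤ.≤_) (sym n*b≡a*d′) (subst (ℤ.0ℤ ℤ.≤_) (ℤ.pos-* a (suc d)) (ℤ.+≤+ ℕ.z≤n)))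
    Q≤0 : Q ℤ.≤ ℤ.0ℤ
    Q≤0 = ℤ.*-cancelʳ-≤-pos Q ℤ.0ℤ d′ (ℤ.≤-trans ([n/ℕd]*d≤n (ℤ.- n) (suc d)) (ℤ.neg-mono-≤ 0≤n))
    ∣⌈q⌉∣ = ℤ.∣ ceiling q ∣
    ∣⌈q⌉∣≡-Q : + ∣⌈q⌉∣ ≡ ℤ.- Q
    ∣⌈q⌉∣≡-Q = trans (ℤ.0≤i⇒+∣i∣≡i (subst (ℤ.0ℤ ℤ.≤_) (sym (ceiling≡-[-↥/↧] q)) (ℤ.neg-mono-≤ Q≤0)))
                     (ceiling≡-[-↥/↧] q)
    -Q*d′<n+d′ : (ℤ.- Q) ℤ.* d′ ℤ.< n ℤ.+ d′
    -Q*d′<n+d′ = subst (ℤ._< n ℤ.+ d′) (shift Q d′) (ℤ.+-monoˡ-< d′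
      (subst (ℤ.- (ℤ.suc Q ℤ.* d′) ℤ.<_) (ℤ.neg-involutive n) (ℤ.neg-mono-< (n<s[n/ℕd]*d (ℤ.- n) (suc d)))))
      where
      shift : ∀ Q d → ℤ.- ((ℤ.1ℤ ℤ.+ Q) ℤ.* d) ℤ.+ d ≡ (ℤ.- Q) ℤ.* d
      shift = ℤ.solve-∀
    ∣⌈q⌉∣*b<a+b : + ∣⌈q⌉∣ ℤ.* + b ℤ.< + a ℤ.+ + b
    ∣⌈q⌉∣*b<a+b = subst (λ t → t ℤ.* + b ℤ.< + a ℤ.+ + b) (sym ∣⌈q⌉∣≡-Q) (ℤ.*-cancelʳ-<-nonNeg d′
      (subst₂ ℤ._<_ (rearrange (ℤ.- Q) d′ (+ b))
                    (trans (distrib n d′ (+ b))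
                           (trans (cong (ℤ._+ + b ℤ.* d′) n*b≡a*d′) (factor (+ a) d′ (+ b))))
                    (ℤ.*-monoʳ-<-pos (+ b) -Q*d′<n+d′)))
      where
      rearrange : ∀ x d b → x ℤ.* d ℤ.* b ≡ (x ℤ.* b) ℤ.* d
      rearrange = ℤ.solve-∀
      distrib : ∀ n d b → (n ℤ.+ d) ℤ.* b ≡ n ℤ.* b ℤ.+ b ℤ.* d
      distrib = ℤ.solve-∀
      factor : ∀ a d b → a ℤ.* d ℤ.+ b ℤ.* d ≡ (a ℤ.+ b) ℤ.* d
      factor = ℤ.solve-∀

open FractionalValue

module Parameters (w : ℕ) where

  X Y S T : ℕ
  X = 3 ^ w
  Y = 2 ^ w
  S = X + Y
  T = 2 * X + Y

  instance
    X≢0 : NonZero X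
    X≢0 = m^n≢0 3 w
    Y≢0 : NonZero Y
    Y≢0 = m^n≢0 2 w

  isFraction-[3/2]^w : IsFraction ((+ 3 ℚ./ 2) ^ℚ w) X Y
  isFraction-[3/2]^w = isFraction-^ℚ (isFraction-/ 3 2) w

  isFraction-r : IsFraction (r w) Y X
  isFraction-r = isFraction-^ℚ (isFraction-/ 2 3) w

  isFraction-β : IsFraction (β w) (3 * X) (1 * Y)
  isFraction-β =
    isFraction-* {+ 3 ℚ./ 1} {(+ 3 ℚ./ 2) ^ℚ w} {3} {1} {X} {Y} (isFraction-/ 3 1) isFraction-[3/2]^w

  isFraction-αsuc : ∀ q → IsFraction (αsuc w q) (X * T ^ q) (S * S ^ q)
  isFraction-αsuc q = isFraction-* {+ X ℚ./ S} {(+ T ℚ./ S) ^ℚ q} {X} {S} {T ^ q} {S ^ q} (isFraction-/ X S)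
    (isFraction-^ℚ {+ T ℚ./ S} {T} {S} (isFraction-/ T S) q)
    where instance _ = nzS w

  isFraction-δ : IsFraction (δ w) ((2 * X + Y * 1) * (3 * X)) ((1 * X) * (1 * Y))
  isFraction-δ = isFraction-* {(+ 2 ℚ./ 1) ℚ.+ r w} {β w} {2 * X + Y * 1} {1 * X} {3 * X} {1 * Y}
    (isFraction-+ {+ 2 ℚ./ 1} {r w} {2} {1} {Y} {X} (isFraction-/ 2 1) isFraction-r) isFraction-β

  -- δ = 6X/Y + 3 and dsize = ⌈δ⌉ < δ + 1.
  dsize*Y<6X+4Y : dsize w * Y < 6 * X + 4 * Y
  dsize*Y<6X+4Y = *-cancelˡ-< X _ _ (subst₂ _<_ (regroup (dsize w) X Y) (factor X Y)
    (∣ceiling∣*b<a+b (δ w) _ (X * Y) {{m*n≢0 X Y}} δ≐num/XY))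
    where
    unit : ∀ x y → (1 * x) * (1 * y) ≡ x * y
    unit = solve-∀
    δ≐num/XY : IsFraction (δ w) ((2 * X + Y * 1) * (3 * X)) (X * Y)
    δ≐num/XY = subst (IsFraction (δ w) ((2 * X + Y * 1) * (3 * X))) (unit X Y) isFraction-δ
    regroup : ∀ d x y → d * (x * y) ≡ x * (d * y)
    regroup = solve-∀
    factor : ∀ x y → (2 * x + y * 1) * (3 * x) + x * y ≡ x * (6 * x + 4 * y)
    factor = solve-∀

  β≤αsuc⇔ : ∀ q → (β w ℚ.≤ αsuc w q → 3 * X * (S * S ^ q) ≤ X * T ^ q * (1 * Y))
                  × (3 * X * (S * S ^ q) ≤ X * T ^ q * (1 * Y) → β w ℚ.≤ αsuc w q)
  β≤αsuc⇔ q =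
    isFraction-≤⇒ {β w} {αsuc w q} {3 * X} {1 * Y} {X * T ^ q} {S * S ^ q} isFraction-β (isFraction-αsuc q) ,
    isFraction-≤⇐ {β w} {αsuc w q} {3 * X} {1 * Y} {X * T ^ q} {S * S ^ q} isFraction-β (isFraction-αsuc q)
      {{subst NonZero (sym (+-identityʳ Y)) Y≢0}} {{m*n≢0 S (S ^ q) {{nzS w}} {{m^n≢0 S q {{nzS w}}}}}}

  T≤2S : T ≤ 2 * S
  T≤2S = subst (T ≤_) (factor X Y) (+-monoʳ-≤ (2 * X) (m≤m+n Y (Y + 0)))
    where
    factor : ∀ x y → 2 * x + (y + (y + 0)) ≡ 2 * (x + y)
    factor = solve-∀

  3S≤2T : 3 * S ≤ 2 * T
  3S≤2T = subst₂ _≤_ (expand X Y) (expand′ X Y) (+-monoʳ-≤ (3 * X + 2 * Y) (^-monoˡ-≤ w (n≤1+n 2)))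
    where
    expand : ∀ x y → 3 * x + 2 * y + y ≡ 3 * (x + y)
    expand = solve-∀
    expand′ : ∀ x y → 3 * x + 2 * y + x ≡ 2 * (2 * x + y)
    expand′ = solve-∀

  -- α(w, q+1)/β(w) = Y T^q / (3 S^(q+1)) ≤ Y 2^q / (3 S), since T ≤ 2S.
  β≤αsuc⇒3X≤Y*2^q : ∀ q → β w ℚ.≤ αsuc w q → 3 * X ≤ Y * 2 ^ q
  β≤αsuc⇒3X≤Y*2^q q β≤α = ≤-trans (*-monoʳ-≤ 3 (m≤m+n X Y))
    (*-cancelˡ-≤ (X * S ^ q) {{m*n≢0 X (S ^ q) {{X≢0}} {{m^n≢0 S q {{nzS w}}}}}} (begin
      (X * S ^ q) * (3 * S)           ≡⟨ regroup X (S ^ q) S ⟩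
      (3 * X) * (S * S ^ q)           ≤⟨ proj₁ (β≤αsuc⇔ q) β≤α ⟩
      (X * T ^ q) * (1 * Y)           ≤⟨ *-monoˡ-≤ (1 * Y) (*-monoʳ-≤ X Tᵠ≤2ᵠSᵠ) ⟩
      (X * (2 ^ q * S ^ q)) * (1 * Y) ≡⟨ regroup′ X (2 ^ q) (S ^ q) Y ⟩
      (X * S ^ q) * (Y * 2 ^ q)       ∎))
    where
    open ≤-Reasoning
    Tᵠ≤2ᵠSᵠ : T ^ q ≤ 2 ^ q * S ^ q
    Tᵠ≤2ᵠSᵠ = subst (T ^ q ≤_) (^-distribʳ-* 2 S q) (^-monoˡ-≤ q T≤2S)
    regroup : ∀ x s′ s → (x * s′) * (3 * s) ≡ (3 * x) * (s * s′)
    regroup = solve-∀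
    regroup′ : ∀ x t s y → (x * (t * s)) * (1 * y) ≡ (x * s) * (y * t)
    regroup′ = solve-∀

  3ᵖSᵖ≤2ᵖTᵖ : ∀ p → 3 ^ p * S ^ p ≤ 2 ^ p * T ^ p
  3ᵖSᵖ≤2ᵖTᵖ p = subst₂ _≤_ (^-distribʳ-* 3 S p) (^-distribʳ-* 2 T p) (^-monoˡ-≤ p 3S≤2T)

  3S*2ᵖ≤Y*3ᵖ : ∀ p → 2 * X ≤ 3 * p * Y → (9 * p + 6) * 2 ^ p ≤ 2 * 3 ^ p → 3 * S * 2 ^ p ≤ Y * 3 ^ p
  3S*2ᵖ≤Y*3ᵖ p 2X≤3pY 9p+6≤ = *-cancelˡ-≤ 2 (begin
    2 * (3 * S * 2 ^ p)               ≡⟨ expand X Y (2 ^ p) ⟩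
    (3 * (2 * X) + 6 * Y) * 2 ^ p     ≤⟨ *-monoˡ-≤ (2 ^ p) (+-monoˡ-≤ (6 * Y) (*-monoʳ-≤ 3 2X≤3pY)) ⟩
    (3 * (3 * p * Y) + 6 * Y) * 2 ^ p ≡⟨ factor p Y (2 ^ p) ⟩
    Y * ((9 * p + 6) * 2 ^ p)         ≤⟨ *-monoʳ-≤ Y 9p+6≤ ⟩
    Y * (2 * 3 ^ p)                   ≡⟨ swap Y (3 ^ p) ⟩
    2 * (Y * 3 ^ p)                   ∎)
    where
    open ≤-Reasoning
    expand : ∀ x y q → 2 * (3 * (x + y) * q) ≡ (3 * (2 * x) + 6 * y) * q
    expand = solve-∀
    factor : ∀ p y q → (3 * (3 * p * y) + 6 * y) * q ≡ y * ((9 * p + 6) * q)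
    factor = solve-∀
    swap : ∀ y q → y * (2 * q) ≡ 2 * (y * q)
    swap = solve-∀

  -- α(w, p+1)/β(w) = Y T^p / (3 S^(p+1)), and (3S)^p ≤ (2T)^p reduces this to 3 S 2^p ≤ Y 3^p.
  β≤αsuc-from : ∀ p → 2 * X ≤ 3 * p * Y → (9 * p + 6) * 2 ^ p ≤ 2 * 3 ^ p → β w ℚ.≤ αsuc w p
  β≤αsuc-from p 2X≤3pY 9p+6≤ = proj₂ (β≤αsuc⇔ p) (begin
    3 * X * (S * S ^ p)         ≡⟨ regroup X S (S ^ p) ⟩
    X * (3 * S * S ^ p)         ≤⟨ *-monoʳ-≤ X 3SSᵖ≤YTᵖ ⟩
    X * (Y * T ^ p)             ≡⟨ regroup′ X Y (T ^ p) ⟩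
    X * T ^ p * (1 * Y)         ∎)
    where
    open ≤-Reasoning
    3SSᵖ≤YTᵖ : 3 * S * S ^ p ≤ Y * T ^ p
    3SSᵖ≤YTᵖ = *-cancelˡ-≤ (2 ^ p) {{m^n≢0 2 p}} (begin
      2 ^ p * (3 * S * S ^ p)  ≡⟨ regroup″ (2 ^ p) S (S ^ p) ⟩
      (3 * S * 2 ^ p) * S ^ p  ≤⟨ *-monoˡ-≤ (S ^ p) (3S*2ᵖ≤Y*3ᵖ p 2X≤3pY 9p+6≤) ⟩
      (Y * 3 ^ p) * S ^ p      ≡⟨ *-assoc Y (3 ^ p) (S ^ p) ⟩
      Y * (3 ^ p * S ^ p)      ≤⟨ *-monoʳ-≤ Y (3ᵖSᵖ≤2ᵖTᵖ p) ⟩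
      Y * (2 ^ p * T ^ p)      ≡⟨ swap Y (2 ^ p) (T ^ p) ⟩
      2 ^ p * (Y * T ^ p)      ∎)
      where
      regroup″ : ∀ q s t → q * (3 * s * t) ≡ (3 * s * q) * t
      regroup″ = solve-∀
      swap : ∀ y q t → y * (q * t) ≡ q * (y * t)
      swap = solve-∀
    regroup : ∀ x s t → 3 * x * (s * t) ≡ x * (3 * s * t)
    regroup = solve-∀
    regroup′ : ∀ x y t → x * (y * t) ≡ x * t * (1 * y)
    regroup′ = solve-∀

module Estimates where

  isCeilLog-0⇒p≤1 : ∀ {p} → IsCeilLog p 0 → p ≤ 1
  isCeilLog-0⇒p≤1 {p} (p≤1 , _) = subst (_≤ 1) (*-identityʳ p)
    (isFraction-≤⇒ {+ p ℚ./ 1} {(+ 3 ℚ./ 2) ^ℚ 0} {p} {1} {1} {1}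
      (isFraction-/ p 1) (Parameters.isFraction-[3/2]^w 0) p≤1)

  isCeilLog-suc⇒3^v<p*2^v : ∀ {p v} → IsCeilLog p (suc v) → 3 ^ v < p * 2 ^ v
  isCeilLog-suc⇒3^v<p*2^v {p} {v} (_ , minimal) =
    subst (_< p * 2 ^ v) (*-identityʳ (3 ^ v)) (≰⇒> λ 3ᵛ≤p2ᵛ → minimal v (n<1+n v)
      (isFraction-≤⇐ {+ p ℚ./ 1} {(+ 3 ℚ./ 2) ^ℚ v} {p} {1} {3 ^ v} {2 ^ v}
        (isFraction-/ p 1) (Parameters.isFraction-[3/2]^w v) {{_}} {{m^n≢0 2 v}} 3ᵛ≤p2ᵛ))

  -- Applied with Z = 3^(w+1), Y = 2^w and P = 2^(p_w).
  ≤-by-ratio : ∀ {Z Y P B c} .{{_ : NonZero Z}} → Z ≤ Y * P → Y * B ≤ Z * c → B ≤ P * c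
  ≤-by-ratio {Z} {Y} {P} {B} {c} Z≤YP YB≤Zc = *-cancelˡ-≤ Z (begin
    Z * B           ≤⟨ *-monoˡ-≤ B Z≤YP ⟩
    Y * P * B       ≡⟨ swap Y P B ⟩
    P * (Y * B)     ≤⟨ *-monoʳ-≤ P YB≤Zc ⟩
    P * (Z * c)     ≡⟨ swap′ P Z c ⟩
    Z * (P * c)     ∎)
    where
    open ≤-Reasoning
    swap : ∀ y q b → y * q * b ≡ q * (y * b)
    swap = solve-∀
    swap′ : ∀ q z c → q * (z * c) ≡ z * (q * c)
    swap′ = solve-∀

  module _ {X Y D p w k : ℕ} .{{_ : NonZero Y}}
           (DY≤6X+4Y : D * Y ≤ 6 * X + 4 * Y) (2X≤3pY : 2 * X ≤ 3 * p * Y)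
           ([1+w]Y≤2X : suc w * Y ≤ 2 * X) (Y≤X : Y ≤ X) (k≤p : k ≤ p) (1≤p : 1 ≤ p) where

    private
      s = suc w

    DY≤10X : D * Y ≤ 10 * X
    DY≤10X = ≤-trans DY≤6X+4Y (subst (6 * X + 4 * Y ≤_) (collect X) (+-monoʳ-≤ (6 * X) (*-monoʳ-≤ 4 Y≤X)))
      where
      collect : ∀ x → 6 * x + 4 * x ≡ 10 * x
      collect = solve-∀

    D≤13p : D ≤ 13 * p
    D≤13p = *-cancelˡ-≤ (Y * 2) {{m*n≢0 Y 2}} (begin
      Y * 2 * D                    ≡⟨ regroup Y D ⟩
      2 * (D * Y)                  ≤⟨ *-monoʳ-≤ 2 DY≤6X+4Y ⟩
      2 * (6 * X + 4 * Y)          ≡⟨ expand X Y ⟩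
      6 * (2 * X) + 8 * (1 * Y)    ≤⟨ +-mono-≤ (*-monoʳ-≤ 6 2X≤3pY) (*-monoʳ-≤ 8 (*-monoˡ-≤ Y 1≤p)) ⟩
      6 * (3 * p * Y) + 8 * (p * Y) ≡⟨ factor Y p ⟩
      Y * 2 * (13 * p)             ∎)
      where
      open ≤-Reasoning
      regroup : ∀ y d → y * 2 * d ≡ 2 * (d * y)
      regroup = solve-∀
      expand : ∀ x y → 2 * (6 * x + 4 * y) ≡ 6 * (2 * x) + 8 * (1 * y)
      expand = solve-∀
      factor : ∀ y p → 6 * (3 * p * y) + 8 * (p * y) ≡ y * 2 * (13 * p)
      factor = solve-∀

    Y*[D+1+w]≤12X : Y * (D + s) ≤ 12 * X
    Y*[D+1+w]≤12X = begin
      Y * (D + s)      ≡⟨ distrib Y D s ⟩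
      D * Y + s * Y    ≤⟨ +-mono-≤ DY≤10X [1+w]Y≤2X ⟩
      10 * X + 2 * X   ≡⟨ collect X ⟩
      12 * X           ∎
      where
      open ≤-Reasoning
      distrib : ∀ y d s → y * (d + s) ≡ d * y + s * y
      distrib = solve-∀
      collect : ∀ x → 10 * x + 2 * x ≡ 12 * x
      collect = solve-∀

    Y*edgeWeight≤ : Y * (D * D + k * (s * (D + s))) ≤ 3 * X * (p * (48 + 4 * w))
    Y*edgeWeight≤ = begin
      Y * (D * D + k * (s * (D + s)))
        ≡⟨ regroup Y D k s ⟩
      (D * Y) * D + k * s * (Y * (D + s))
        ≤⟨ +-mono-≤ (*-mono-≤ DY≤10X D≤13p) (*-mono-≤ (*-monoˡ-≤ s k≤p) Y*[D+1+w]≤12X) ⟩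
      10 * X * (13 * p) + p * s * (12 * X)
        ≤⟨ m≤m+n _ (2 * (X * p)) ⟩
      10 * X * (13 * p) + p * s * (12 * X) + 2 * (X * p)
        ≡⟨ collect X p w ⟩
      3 * X * (p * (48 + 4 * w)) ∎
      where
      open ≤-Reasoning
      regroup : ∀ y d k s → y * (d * d + k * (s * (d + s))) ≡ (d * y) * d + k * s * (y * (d + s))
      regroup = solve-∀
      collect : ∀ x p w → 10 * x * (13 * p) + p * suc w * (12 * x) + 2 * (x * p) ≡ 3 * x * (p * (48 + 4 * w))
      collect = solve-∀

  module _ {p v : ℕ} (10≤p : 10 ≤ p) (isCeilLog : IsCeilLog p (suc v)) where
    private
      w = suc v
      open Parameters w using (X; Y; X≢0; Y≢0; dsize*Y<6X+4Y; β≤αsuc⇒3X≤Y*2^q; β≤αsuc-from)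

    3ᵛ≤p*2ᵛ : 3 ^ v ≤ p * 2 ^ v
    3ᵛ≤p*2ᵛ = <⇒≤ (isCeilLog-suc⇒3^v<p*2^v {p} {v} isCeilLog)

    2X≤3pY : 2 * X ≤ 3 * p * Y
    2X≤3pY = subst₂ _≤_ (swap (3 ^ v)) (regroup p (2 ^ v)) (*-monoʳ-≤ 6 3ᵛ≤p*2ᵛ)
      where
      swap : ∀ x → 6 * x ≡ 2 * (3 * x)
      swap = solve-∀
      regroup : ∀ p y → 6 * (p * y) ≡ 3 * p * (2 * y)
      regroup = solve-∀

    pw≤p : ∀ {pw} → IsPw w pw → pw ≤ p
    pw≤p (_ , minimal) = ≮⇒≥ λ p<pw → minimal p p<pw (β≤αsuc-from p 2X≤3pY ([9n+6]*2^n≤2*3^n 10≤p))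

    edgesG≤ : ∀ {pw} → IsPw w pw → edgesG w pw p ≤ 2 ^ p * (p * (48 + 4 * w))
    edgesG≤ {pw} isPw@(β≤α , _) = begin
      edgeCount w k                  ≤⟨ edgeCount-≤ w k ⟩
      2 ^ k * B                      ≤⟨ *-monoʳ-≤ (2 ^ k) B≤2ᵖʷc ⟩
      2 ^ k * (2 ^ pw * c)           ≡⟨ *-assoc (2 ^ k) (2 ^ pw) c ⟨
      2 ^ k * 2 ^ pw * c             ≡⟨ cong (_* c) 2ᵏ2ᵖʷ≡2ᵖ ⟩
      2 ^ p * c                      ∎
      where
      open ≤-Reasoning
      k = p ∸ pw
      c = p * (48 + 4 * w)
      B = dsize w * dsize w + k * (suc w * (dsize w + suc w))
      Y*B≤3X*c : Y * B ≤ 3 * X * c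
      Y*B≤3X*c = Y*edgeWeight≤ {X} {Y} {dsize w} {p} {w} {k} (<⇒≤ dsize*Y<6X+4Y) 2X≤3pY
        ([1+n]*2^n≤2*3^n w) (^-monoˡ-≤ w (n≤1+n 2)) (m∸n≤m p pw) (≤-trans (s≤s z≤n) 10≤p)
      B≤2ᵖʷc : B ≤ 2 ^ pw * c
      B≤2ᵖʷc = ≤-by-ratio {3 * X} {Y} {2 ^ pw} {{m*n≢0 3 X}} (β≤αsuc⇒3X≤Y*2^q pw β≤α) Y*B≤3X*c
      2ᵏ2ᵖʷ≡2ᵖ : 2 ^ k * 2 ^ pw ≡ 2 ^ p
      2ᵏ2ᵖʷ≡2ᵖ = trans (sym (^-distribˡ-+-* 2 k pw)) (cong (2 ^_) (m∸n+n≡m (pw≤p isPw)))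

  -- a - M ≤ v b with (3/2)^v ≤ p gives (3/2)^(a - M) ≤ p^b; a negative difference is harmless.
  leMulLog-intro : ∀ {a M b p v} → 3 ^ v ≤ p * 2 ^ v → a ≤ M + v * b → LeMulLog (+ a ℤ.- + M) b p
  leMulLog-intro {a} {M} {b} {p} {v} 3ᵛ≤p2ᵛ a≤M+vb with M ≤? a
  ... | yes M≤a = subst (λ z → LeMulLog z b p) (sym (trans (ℤ.m-n≡m⊖n a M) (ℤ.⊖-≥ M≤a)))
        (^-ratio-≤-antitone (n≤1+n 2) {p ^ b} {v * b} (^-ratio-≤-^ {2} {3} {p} {v} b 3ᵛ≤p2ᵛ) a∸M≤vb)
    where
    a∸M≤vb : a ∸ M ≤ v * b
    a∸M≤vb = subst (a ∸ M ≤_) (m+n∸m≡n M (v * b)) (∸-monoˡ-≤ M a≤M+vb)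
  ... | no M≰a = subst (λ z → LeMulLog z b p) (sym (trans (ℤ.m-n≡m⊖n a M) (ℤ.⊖-< (≰⇒> M≰a))))
        (negative (m<n⇒0<n∸m (≰⇒> M≰a)))
    where
    negative : ∀ {n} → 0 < n → LeMulLog (ℤ.- + n) b p
    negative {suc n} _ = tt

  ≤53+5v : ∀ P p v → P * (p * (48 + 4 * suc v)) ≤ 53 * P * p + v * (5 * P * p)
  ≤53+5v P p v = ≤-trans (m≤m+n (P * (p * (48 + 4 * suc v))) (P * p * (1 + v))) (≤-reflexive (collect P p v))
    where
    collect : ∀ P p v → P * (p * (48 + 4 * suc v)) + P * p * (1 + v) ≡ 53 * P * p + v * (5 * P * p)
    collect = solve-∀

open Estimates

lemma3p10 : Σ ℕ λ C → Σ ℕ λ N → ∀ p → N ≤ p → ∀ w → IsCeilLog p w → ∀ pw → IsPw w pw → (pw ≤ p) × LeMulLog (+ edgesG w pw p - + (C * 2 ^ p * p)) (5 * 2 ^ p * p) p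
lemma3p10 = 53 , 10 , bound
  where
  bound : ∀ p → 10 ≤ p → ∀ w → IsCeilLog p w → ∀ pw → IsPw w pw →
          (pw ≤ p) × LeMulLog (+ edgesG w pw p - + (53 * 2 ^ p * p)) (5 * 2 ^ p * p) p
  bound p 10≤p zero    isCeilLog pw isPw =
    contradiction (isCeilLog-0⇒p≤1 isCeilLog) (<⇒≱ (≤-trans (s≤s (s≤s z≤n)) 10≤p))
  bound p 10≤p (suc v) isCeilLog pw isPw =
    pw≤p 10≤p isCeilLog isPw ,
    leMulLog-intro {M = 53 * 2 ^ p * p} {5 * 2 ^ p * p} {p} {v} (3ᵛ≤p*2ᵛ 10≤p isCeilLog)
      (≤-trans (edgesG≤ 10≤p isCeilLog isPw) (≤53+5v (2 ^ p) p v))
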